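{- Let $T$ be a tree on $n\ge 3$ vertices. Then $T$ is uniquely reconstructible from its $(\le n-1)$-graphlet degree distribution. That is, every tree $T'$ on $n$ vertices whose $(\le n-1)$-graphlet degree distribution equals that of $T$ (for suitable orderings of the vertex sets) is isomorphic to $T$.
   Context: All graphs are finite, simple and undirected. Let $H$ be a graph on $n$ vertices. A graphlet is a pair $(G,r)$ with $G$ a connected graph with at least one and fewer than $n$ vertices and $r\in V(G)$. Two graphlets are isomorphic if some isomorphism of the graphs maps root to root; graphlets are taken up to isomorphism in a fixed enumeration. For $v\in V(H)$, the graphlet degree of $v$ with respect to $(G,r)$ is the number of sets $S\subseteq V(H)$ with $v\in S$ such that some isomorphism $H[S]\to G$ maps $v$ to $r$. The $(\le m)$-graphlet degree distribution of $H$ is the matrix with rows indexed by the vertices of $H$ and columns by the graphlet classes with at most $m$ vertices. Its entries are the corresponding graphlet degrees. -}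

module Defs where

open import Data.Nat using (ℕ; zero; suc; _≤_; _<_; _∸_)
open import Data.Bool using (Bool; true; false; _∧_; _∨_; not; if_then_else_)
open import Data.Fin using (Fin; zero; suc; _≟_)
open import Data.List using (List; []; _∷_; [_]; _++_; length; map; concatMap; allFin; filter)
open import Data.Bool.ListAction using (all; any)
open import Data.List.Relation.Unary.Unique.Propositional using (Unique)
open import Data.Vec using (Vec; []; _∷_; lookup)
open import Data.Product using (Σ; _×_; _,_; ∃)
open import Relation.Nullary using (¬_; does)
open import Relation.Binary.PropositionalEquality using (_≡_)
open import Function.Bundles using (_↔_; Inverse)

record Graph (n : ℕ) : Set where
  field
    adj    : Fin n → Fin n → Bool
    sym    : ∀ i j → adj i j ≡ adj j i
    irrefl : ∀ i → adj i i ≡ false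
open Graph public

data Walk {n : ℕ} (G : Graph n) : Fin n → Fin n → Set where
  here : ∀ {i} → Walk G i i
  step : ∀ {i k j} → adj G i k ≡ true → Walk G k j → Walk G i j

Connected : ∀ {n} → Graph n → Set
Connected G = ∀ i j → Walk G i j

data Chain {n : ℕ} (G : Graph n) : List (Fin n) → Set where
  nil  : Chain G []
  one  : ∀ {v} → Chain G (v ∷ [])
  cons : ∀ {u v vs} → adj G u v ≡ true → Chain G (v ∷ vs) → Chain G (u ∷ v ∷ vs)

IsCycle : ∀ {n} → Graph n → Fin n → List (Fin n) → Set
IsCycle G v ws = Unique (v ∷ ws) × (2 ≤ length ws) × Chain G (v ∷ ws ++ [ v ])

Acyclic : ∀ {n} → Graph n → Set
Acyclic G = ∀ v ws → ¬ IsCycle G v ws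

Tree : ∀ {n} → Graph n → Set
Tree G = Connected G × Acyclic G

IsIso : ∀ {n m} → Graph n → Graph m → (Fin n ↔ Fin m) → Set
IsIso G G' f = ∀ i j → adj G' (Inverse.to f i) (Inverse.to f j) ≡ adj G i j

Isomorphic : ∀ {n m} → Graph n → Graph m → Set
Isomorphic G G' = Σ (Fin _ ↔ Fin _) (IsIso G G')

allF : ∀ {n} → (Fin n → Bool) → Bool
allF p = all p (allFin _)

anyF : ∀ {n} → (Fin n → Bool) → Bool
anyF p = any p (allFin _)

_==_ : ∀ {n} → Fin n → Fin n → Bool
a == b = does (a ≟ b)

_⇒ᵇ_ : Bool → Bool → Bool
a ⇒ᵇ b = not a ∨ b

_⇔ᵇ_ : Bool → Bool → Bool
true  ⇔ᵇ b = b
false ⇔ᵇ b = not b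

-- all subsets of Fin n (as characteristic vectors)
Subset : ℕ → Set
Subset n = Vec Bool n

allSubsets : (n : ℕ) → List (Subset n)
allSubsets zero    = [] ∷ []
allSubsets (suc n) = concatMap (λ s → (true ∷ s) ∷ (false ∷ s) ∷ []) (allSubsets n)

-- all maps Fin k → Fin n (as vectors)
allMaps : (k n : ℕ) → List (Vec (Fin n) k)
allMaps zero    n = [] ∷ []
allMaps (suc k) n = concatMap (λ f → map (λ x → x ∷ f) (allFin n)) (allMaps k n)

-- Graphlets and graphlet degrees.
-- A graphlet with k+1 vertices is a connected graph G on Fin (suc k) with a root r.

-- f : Fin (suc k) → Fin n is an isomorphism G ≅ H[S] sending r to v
-- (equivalently its inverse is an isomorphism H[S] → G sending v to r):
-- f injective, image of f equals S, adjacency preserved and reflected, f r = v.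
isRootedIsoᵇ : ∀ {k n} → Graph (suc k) → Fin (suc k) → Graph n → Fin n
             → Subset n → Vec (Fin n) (suc k) → Bool
isRootedIsoᵇ G r H v S f =
  (lookup f r == v)
  ∧ allF (λ a → allF (λ b → (lookup f a == lookup f b) ⇒ᵇ (a == b)))
  ∧ allF (λ a → lookup S (lookup f a))
  ∧ allF (λ i → lookup S i ⇒ᵇ anyF (λ a → lookup f a == i))
  ∧ allF (λ a → allF (λ b → adj G a b ⇔ᵇ adj H (lookup f a) (lookup f b)))

rootedIsoᵇ : ∀ {k n} → Graph (suc k) → Fin (suc k) → Graph n → Fin n → Subset n → Bool
rootedIsoᵇ {k} {n} G r H v S =
  lookup S v ∧ any (isRootedIsoᵇ G r H v S) (allMaps (suc k) n)

graphletDegree : ∀ {k n} → Graph n → Fin n → Graph (suc k) → Fin (suc k) → ℕ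
graphletDegree H v G r = length (filter (λ S → rootedIsoᵇ G r H v S ≡? true) (allSubsets _))
  where
    open import Data.Bool.Properties using () renaming (_≟_ to _≡?_)

-- Equality of (≤ m)-graphlet degree distributions up to reordering the
-- rows (vertices): a bijection σ of the vertex sets such that, for every
-- graphlet (G , r) with at most m vertices (and fewer than n), the graphlet
-- degree of v in H equals that of σ v in H'.

SameGDD : ∀ {n} → ℕ → Graph n → Graph n → Set
SameGDD {n} m H H' =
  Σ (Fin n ↔ Fin n) λ σ →
    ∀ (k : ℕ) → suc k ≤ m → suc k < n →
    (G : Graph (suc k)) → Connected G → (r : Fin (suc k)) →
    ∀ v → graphletDegree H v G r ≡ graphletDegree H' (Inverse.to σ v) G r

{-# OPTIONS --safe #-}
-- Let ℓ be a leaf of T attached at u. The rooted graphlet (T − ℓ, u) has n − 1 vertices and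
-- occurs at u, so it occurs at σ u in T′: there is an induced embedding F of T − ℓ into T′
-- with F u = σ u, missing exactly one vertex w. The graphlet K₂ counts neighbours, so σ u has
-- the degree of u; as F accounts for all neighbours of u except ℓ, σ u must be adjacent to w.
-- Any other neighbour of w would close a cycle with the image of a path of the connected graph
-- T − ℓ, so w is a leaf of T′ at σ u and F extends by ℓ ↦ w to an isomorphism T ≅ T′.
module Submission where

open import Defs hiding (sym)
open import Data.Bool using (Bool; true; false; T; _∧_; not)
open import Data.Bool.ListAction using (or)
open import Data.Bool.Properties using (T-≡; T-∧; ⇔→≡) renaming (_≟_ to _≟ᵇ_)
open import Data.Empty using (⊥-elim)
open import Data.Fin using (Fin; zero; suc; _≟_; punchIn; punchOut)
open import Data.Fin.Properties
  using (any?; ¬∀⟶∃¬; injective⇒≤; punchOut-injective; punchIn-injective; punchInᵢ≢i; punchIn-punchOut)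
open import Data.List
  using (List; []; _∷_; _++_; [_]; length; map; concatMap; filter; allFin; cartesianProductWith)
open import Data.List.Membership.Propositional using (_∈_; _∉_; lose)
open import Data.List.Membership.Propositional.Properties
  using ( ∈-∃++; ∈-++⁻; ∈-++⁺ˡ; ∈-++⁺ʳ; ∈-cartesianProductWith⁺; ∈-allFin
        ; ∈-filter⁺; ∈-filter⁻; ∈-map⁺; ∈-map⁻)
open import Data.List.Properties using (map-cong; length-map; length-tabulate)
open import Data.List.Relation.Binary.Subset.Propositional using (_⊆_)
open import Data.List.Relation.Binary.Subset.Propositional.Properties using (⊆-refl; ∷⁺ʳ)
import Data.List.Membership.DecPropositional as DecMembership
open import Data.List.Relation.Unary.All.Properties.Core using (¬Any⇒All¬; All¬⇒¬Any)
open import Data.List.Relation.Binary.Permutation.Propositional.Properties using (↭-length; shift)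
import Data.List.Relation.Unary.All as All
import Data.List.Relation.Unary.All.Properties as All
open import Data.List.Relation.Unary.Any using (here; there; satisfied)
import Data.List.Relation.Unary.Any.Properties as Any
open import Data.List.Relation.Unary.Unique.Propositional using (Unique; []; _∷_)
import Data.List.Relation.Unary.Unique.Propositional.Properties as Unique
open import Data.Nat using (ℕ; zero; suc; _+_; _∸_; _≤_; _<_; z≤n; s≤s; z<s)
open import Data.Nat.Properties
  using (≤-refl; ≤-reflexive; +-suc; m≤m+n; ≤-trans; ≤-antisym; 1+n≰n; <⇒≱; module ≤-Reasoning)
open import Data.Product using (Σ-syntax; ∃; ∃₂; _×_; _,_; proj₁; proj₂)
open import Data.Sum using (inj₁; inj₂)
open import Data.Vec using (Vec; []; _∷_; lookup; tabulate)
open import Data.Vec.Properties using (lookup∘tabulate; tabulate∘lookup; tabulate-cong)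
open import Function
  using (_∘_; id; const; flip; _⇔_; mk⇔; Equivalence; Injective; _↔_; mk↔ₛ′; Inverse)
open Equivalence using (to; from)
open import Relation.Nullary using (Dec; ¬?; yes; no; _×-dec_; contradiction)
open import Relation.Nullary.Decidable using (decidable-stable)
open import Relation.Binary.PropositionalEquality
  using (_≡_; _≢_; refl; sym; trans; cong; cong₂; subst; _≗_; module ≡-Reasoning)

T-∧-intro : ∀ {a b} → T a → T b → T (a ∧ b)
T-∧-intro ta tb = from T-∧ (ta , tb)

T-ext : ∀ {a b} → (T a → T b) → (T b → T a) → a ≡ b
T-ext {true}  {true}  _ _ = refl
T-ext {true}  {false} f _ = ⊥-elim (f _)
T-ext {false} {true}  _ g = ⊥-elim (g _)
T-ext {false} {false} _ _ = refl

T-== : ∀ {n} {a b : Fin n} → T (a == b) ⇔ a ≡ b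
T-== {a = a} {b} with a ≟ b
... | yes a≡b = mk⇔ (const a≡b) (const _)
... | no  a≢b = mk⇔ (λ ()) a≢b

T-⇒ᵇ : ∀ {a b} → T (a ⇒ᵇ b) ⇔ (T a → T b)
T-⇒ᵇ {true}  = mk⇔ const (λ f → f _)
T-⇒ᵇ {false} = mk⇔ (λ _ ()) _

T-⇔ᵇ : ∀ {a b} → T (a ⇔ᵇ b) ⇔ (a ≡ b)
T-⇔ᵇ {true}  {true}  = mk⇔ (const refl) _
T-⇔ᵇ {true}  {false} = mk⇔ (λ ()) (λ ())
T-⇔ᵇ {false} {true}  = mk⇔ (λ ()) (λ ())
T-⇔ᵇ {false} {false} = mk⇔ (const refl) _

allF⁺ : ∀ {n} (p : Fin n → Bool) → (∀ i → T (p i)) → T (allF p)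
allF⁺ p = All.all⁻ p ∘ All.tabulate⁺

allF⁻ : ∀ {n} (p : Fin n → Bool) → T (allF p) → ∀ i → T (p i)
allF⁻ p = All.tabulate⁻ ∘ All.all⁺ p (allFin _)

anyF⁺ : ∀ {n} (p : Fin n → Bool) i → T (p i) → T (anyF p)
anyF⁺ p i = Any.any⁺ p ∘ Any.tabulate⁺ i

anyF⁻ : ∀ {n} (p : Fin n → Bool) → T (anyF p) → ∃ λ i → T (p i)
anyF⁻ p = Any.tabulate⁻ ∘ Any.any⁻ p (allFin _)

concatMap≡cartesianProductWith : ∀ {A B C : Set} (f : A → B → C) xs ys →
  concatMap (λ x → map (f x) ys) xs ≡ cartesianProductWith f xs ys
concatMap≡cartesianProductWith f []       ys = refl
concatMap≡cartesianProductWith f (x ∷ xs) ys =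
  cong (map (f x) ys ++_) (concatMap≡cartesianProductWith f xs ys)

allSubsets-suc : ∀ n →
  allSubsets (suc n) ≡ cartesianProductWith (flip _∷_) (allSubsets n) (true ∷ false ∷ [])
allSubsets-suc n = concatMap≡cartesianProductWith (flip _∷_) (allSubsets n) _

allMaps-suc : ∀ k n → allMaps (suc k) n ≡ cartesianProductWith (flip _∷_) (allMaps k n) (allFin n)
allMaps-suc k n = concatMap≡cartesianProductWith (flip _∷_) (allMaps k n) _

∈-allSubsets : ∀ {n} (S : Subset n) → S ∈ allSubsets n
∈-allSubsets []      = here refl
∈-allSubsets {suc n} (b ∷ S) = subst ((b ∷ S) ∈_) (sym (allSubsets-suc n))
  (∈-cartesianProductWith⁺ (flip _∷_) (∈-allSubsets S) (∈-bools b))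
  where
  ∈-bools : ∀ b → b ∈ true ∷ false ∷ []
  ∈-bools true  = here refl
  ∈-bools false = there (here refl)

allSubsets-unique : ∀ n → Unique (allSubsets n)
allSubsets-unique zero    = All.[] ∷ []
allSubsets-unique (suc n) = subst Unique (sym (allSubsets-suc n))
  (Unique.cartesianProductWith⁺ (flip _∷_) ∷-injective′ (allSubsets-unique n)
    (((λ ()) All.∷ All.[]) ∷ All.[] ∷ []))
  where
  ∷-injective′ : ∀ {S S′ : Subset n} {b b′} → b ∷ S ≡ b′ ∷ S′ → S ≡ S′ × b ≡ b′
  ∷-injective′ refl = refl , refl

∈-allMaps : ∀ {k n} (f : Vec (Fin n) k) → f ∈ allMaps k n
∈-allMaps []      = here refl
∈-allMaps {suc k} {n} (x ∷ f) = subst ((x ∷ f) ∈_) (sym (allMaps-suc k n))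
  (∈-cartesianProductWith⁺ (flip _∷_) (∈-allMaps f) (∈-allFin x))

length-mono-⊆ : ∀ {A : Set} {xs ys : List A} → Unique xs → xs ⊆ ys → length xs ≤ length ys
length-mono-⊆ {xs = []}     _            _     = z≤n
length-mono-⊆ {xs = x ∷ xs} (x∉xs ∷ xs!) xs⊆ys
  with as , bs , refl ← ∈-∃++ (xs⊆ys (here refl)) =
  begin
    suc (length xs)            ≤⟨ s≤s (length-mono-⊆ xs! drop-x) ⟩
    suc (length (as ++ bs))    ≡⟨ ↭-length (shift x as bs) ⟨
    length (as ++ [ x ] ++ bs) ∎
  where
  open ≤-Reasoning
  drop-x : xs ⊆ as ++ bs
  drop-x {y} y∈xs with ∈-++⁻ as (xs⊆ys (there y∈xs))
  ... | inj₁ y∈as         = ∈-++⁺ˡ y∈as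
  ... | inj₂ (here refl)  = contradiction refl (All.lookup x∉xs y∈xs)
  ... | inj₂ (there y∈bs) = ∈-++⁺ʳ as y∈bs

record IsRootedIso {k n} (G : Graph (suc k)) (r : Fin (suc k)) (H : Graph n) (v : Fin n)
                   (S : Subset n) (F : Fin (suc k) → Fin n) : Set where
  field
    root      : F r ≡ v
    injective : Injective _≡_ _≡_ F
    image⊆S   : ∀ a → T (lookup S (F a))
    S⊆image   : ∀ i → T (lookup S i) → ∃ λ a → F a ≡ i
    preserves : ∀ a b → adj G a b ≡ adj H (F a) (F b)

module _ {k n} {G : Graph (suc k)} {r : Fin (suc k)} {H : Graph n} {v : Fin n} {S : Subset n} where

  isRootedIsoᵇ-sound : ∀ {f} → T (isRootedIsoᵇ G r H v S f) → IsRootedIso G r H v S (lookup f)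
  isRootedIsoᵇ-sound {f} t =
    let root    , t₁   = ∧⁻ (F r == v) t
        inj     , t₂   = ∧⁻ (allF λ a → allF λ b → (F a == F b) ⇒ᵇ (a == b)) t₁
        image⊆S , t₃   = ∧⁻ (allF λ a → lookup S (F a)) t₂
        S⊆image , pres = ∧⁻ (allF λ i → lookup S i ⇒ᵇ anyF (λ a → F a == i)) t₃
    in record
      { root      = to T-== root
      ; injective = λ {a} {b} e → to T-==
          (to T-⇒ᵇ (allF⁻ _ (allF⁻ _ inj a) b) (from T-== e))
      ; image⊆S   = allF⁻ _ image⊆S
      ; S⊆image   = λ i s → let a , e = anyF⁻ _ (to T-⇒ᵇ (allF⁻ _ S⊆image i) s)
                            in a , to T-== e
      ; preserves = λ a b → to T-⇔ᵇ (allF⁻ _ (allF⁻ _ pres a) b)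
      }
    where
    F : Fin (suc k) → Fin n
    F = lookup f
    ∧⁻ : ∀ a {b} → T (a ∧ b) → T a × T b
    ∧⁻ _ = to T-∧

  isRootedIsoᵇ-complete : ∀ {f} → IsRootedIso G r H v S (lookup f) → T (isRootedIsoᵇ G r H v S f)
  isRootedIsoᵇ-complete {f} iso =
    T-∧-intro (from T-== root) (T-∧-intro
      (allF⁺ _ λ a → allF⁺ (λ b → (F a == F b) ⇒ᵇ (a == b)) λ b →
         from T-⇒ᵇ (from T-== ∘ injective ∘ to T-==)) (T-∧-intro
      (allF⁺ (λ a → lookup S (F a)) image⊆S) (T-∧-intro
      (allF⁺ (λ i → lookup S i ⇒ᵇ anyF (λ a → F a == i)) λ i → from T-⇒ᵇ λ s →
         let a , e = S⊆image i s in anyF⁺ (λ a → F a == i) a (from T-== e))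
      (allF⁺ _ λ a → allF⁺ (λ b → adj G a b ⇔ᵇ adj H (F a) (F b)) λ b →
         from T-⇔ᵇ (preserves a b)))))
    where
    open IsRootedIso iso
    F : Fin (suc k) → Fin n
    F = lookup f

  IsRootedIso-cong : ∀ {F F′} → F ≗ F′ → IsRootedIso G r H v S F → IsRootedIso G r H v S F′
  IsRootedIso-cong {F} {F′} F≗F′ iso = record
    { root      = trans (sym (F≗F′ r)) root
    ; injective = λ e → injective (trans (F≗F′ _) (trans e (sym (F≗F′ _))))
    ; image⊆S   = λ a → subst (T ∘ lookup S) (F≗F′ a) (image⊆S a)
    ; S⊆image   = λ i s → let a , e = S⊆image i s in a , trans (sym (F≗F′ a)) e
    ; preserves = λ a b → trans (preserves a b) (cong₂ (adj H) (F≗F′ a) (F≗F′ b))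
    }
    where open IsRootedIso iso

  rootedIsoᵇ-sound : rootedIsoᵇ G r H v S ≡ true → ∃ (IsRootedIso G r H v S)
  rootedIsoᵇ-sound e =
    let f , t = satisfied (Any.any⁻ _ (allMaps (suc k) n) (proj₂ (to T-∧ (subst T (sym e) _))))
    in lookup f , isRootedIsoᵇ-sound {f} t

  rootedIsoᵇ-complete : ∀ {F} → IsRootedIso G r H v S F → rootedIsoᵇ G r H v S ≡ true
  rootedIsoᵇ-complete {F} iso = to T-≡ (T-∧-intro
    (subst (T ∘ lookup S) root (image⊆S r))
    (Any.any⁺ _ (lose (∈-allMaps (tabulate F))
      (isRootedIsoᵇ-complete {tabulate F} (IsRootedIso-cong (sym ∘ lookup∘tabulate F) iso)))))
    where open IsRootedIso iso

image : ∀ {k n} → (Fin k → Fin n) → Subset n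
image F = tabulate λ i → anyF λ a → F a == i

module _ {k n} (F : Fin k → Fin n) where

  image⁺ : ∀ a → T (lookup (image F) (F a))
  image⁺ a = subst T (sym (lookup∘tabulate _ (F a)))
    (anyF⁺ (λ b → F b == F a) a (from (T-== {a = F a}) refl))

  image⁻ : ∀ {i} → T (lookup (image F) i) → ∃ λ a → F a ≡ i
  image⁻ {i} t = let a , e = anyF⁻ (λ a → F a == i) (subst T (lookup∘tabulate _ i) t)
                 in a , to T-== e

  image-cong : ∀ {F′} → F ≗ F′ → image F ≡ image F′
  image-cong F≗F′ =
    tabulate-cong λ i → cong or (map-cong (λ a → cong (_== i) (F≗F′ a)) (allFin k))

module _ {k n} {G : Graph (suc k)} {r : Fin (suc k)} {H : Graph n} {v : Fin n} where

  image-isRootedIso : ∀ {F} → F r ≡ v → Injective _≡_ _≡_ F →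
                      (∀ a b → adj G a b ≡ adj H (F a) (F b)) → IsRootedIso G r H v (image F) F
  image-isRootedIso {F} root injective preserves = record
    { root      = root
    ; injective = injective
    ; image⊆S   = image⁺ F
    ; S⊆image   = λ _ → image⁻ F
    ; preserves = preserves
    }

  isRootedIso⇒image : ∀ {S F} → IsRootedIso G r H v S F → S ≡ image F
  isRootedIso⇒image {S} {F} iso = begin
    S                           ≡⟨ tabulate∘lookup S ⟨
    tabulate (lookup S)         ≡⟨ tabulate-cong same-elements ⟩
    tabulate (lookup (image F)) ≡⟨ tabulate∘lookup (image F) ⟩
    image F                     ∎
    where
    open IsRootedIso iso
    open ≡-Reasoning
    same-elements : lookup S ≗ lookup (image F)
    same-elements i = T-ext
      (λ s → let a , Fa≡i = S⊆image i s in subst (T ∘ lookup (image F)) Fa≡i (image⁺ F a))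
      (λ t → let a , Fa≡i = image⁻ F t in subst (T ∘ lookup S) Fa≡i (image⊆S a))

graphletSubsets : ∀ {k n} → Graph n → Fin n → Graph (suc k) → Fin (suc k) → List (Subset n)
graphletSubsets H v G r = filter (λ S → rootedIsoᵇ G r H v S ≟ᵇ true) (allSubsets _)

∈-graphletSubsets : ∀ {k n} (H : Graph n) v (G : Graph (suc k)) r {S} →
                    S ∈ graphletSubsets H v G r ⇔ ∃ (IsRootedIso G r H v S)
∈-graphletSubsets {n = n} H v G r {S} = mk⇔
  (rootedIsoᵇ-sound ∘ proj₂ ∘ ∈-filter⁻ test {xs = allSubsets n})
  (∈-filter⁺ test (∈-allSubsets S) ∘ rootedIsoᵇ-complete ∘ proj₂)
  where
  test : ∀ S → Dec (rootedIsoᵇ G r H v S ≡ true)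
  test S = rootedIsoᵇ G r H v S ≟ᵇ true

graphletDegree>0⇔ : ∀ {k n} (H : Graph n) v (G : Graph (suc k)) r →
                    0 < graphletDegree H v G r ⇔ ∃₂ (IsRootedIso G r H v)
graphletDegree>0⇔ H v G r = mk⇔ (witness ∘ nonempty)
  (λ (S , iso) → length>0 (from (∈-graphletSubsets H v G r) iso))
  where
  length>0 : ∀ {A : Set} {x : A} {xs} → x ∈ xs → 0 < length xs
  length>0 {xs = _ ∷ _} _ = z<s
  nonempty : 0 < graphletDegree H v G r → ∃ (_∈ graphletSubsets H v G r)
  nonempty _ with graphletSubsets H v G r
  ... | S ∷ _ = S , here refl
  witness : ∃ (_∈ graphletSubsets H v G r) → ∃₂ (IsRootedIso G r H v)
  witness (S , S∈) = S , to (∈-graphletSubsets H v G r) S∈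

K2 : Graph 2
K2 = record { adj = λ a b → not (a == b) ; sym = symmetric ; irrefl = irreflexive }
  where
  symmetric : ∀ a b → not (a == b) ≡ not (b == a)
  symmetric zero       zero       = refl
  symmetric zero       (suc zero) = refl
  symmetric (suc zero) zero       = refl
  symmetric (suc zero) (suc zero) = refl
  irreflexive : ∀ a → not (a == a) ≡ false
  irreflexive zero       = refl
  irreflexive (suc zero) = refl

K2-connected : Connected K2
K2-connected zero       zero       = here
K2-connected zero       (suc zero) = step refl here
K2-connected (suc zero) zero       = step refl here
K2-connected (suc zero) (suc zero) = here

neighbours : ∀ {n} → Graph n → Fin n → List (Fin n)
neighbours H v = filter (λ x → adj H v x ≟ᵇ true) (allFin _)

degree : ∀ {n} → Graph n → Fin n → ℕ
degree H v = length (neighbours H v)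

∈-neighbours : ∀ {n} (H : Graph n) v {x} → x ∈ neighbours H v ⇔ adj H v x ≡ true
∈-neighbours H v {x} = mk⇔
  (proj₂ ∘ ∈-filter⁻ (λ x → adj H v x ≟ᵇ true) {xs = allFin _})
  (∈-filter⁺ (λ x → adj H v x ≟ᵇ true) (∈-allFin x))

adj⇒≢ : ∀ {n} (H : Graph n) {x y} → adj H x y ≡ true → x ≢ y
adj⇒≢ H {x} xy refl = contradiction (trans (sym xy) (irrefl H x)) λ ()

edge : ∀ {n} → Fin n → Fin n → Fin 2 → Fin n
edge v x = lookup (v ∷ x ∷ [])

pair : ∀ {n} → Fin n → Fin n → Subset n
pair v x = image (edge v x)

pair-injective : ∀ {n} {v x y : Fin n} → pair v x ≡ pair v y → x ≡ y
pair-injective {v = v} {x} {y} eq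
  with image⁻ (edge v y) (subst (λ S → T (lookup S x)) eq (image⁺ (edge v x) (suc zero)))
     | image⁻ (edge v x) (subst (λ S → T (lookup S y)) (sym eq) (image⁺ (edge v y) (suc zero)))
... | suc zero , y≡x | _              = sym y≡x
... | zero , v≡x     | suc zero , x≡y = x≡y
... | zero , v≡x     | zero , v≡y     = trans (sym v≡x) v≡y

module _ {n} (H : Graph n) (v : Fin n) where

  isRootedIso-K2⇔pair : ∀ {S} →
    ∃ (IsRootedIso K2 zero H v S) ⇔ ∃ λ x → adj H v x ≡ true × S ≡ pair v x
  isRootedIso-K2⇔pair {S} = mk⇔ ⇒pair pair⇒
    where
    ⇒pair : ∃ (IsRootedIso K2 zero H v S) → ∃ λ x → adj H v x ≡ true × S ≡ pair v x
    ⇒pair (F , iso) = F (suc zero)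
                    , subst (λ u → adj H u (F (suc zero)) ≡ true) root (sym (preserves zero (suc zero)))
                    , trans (isRootedIso⇒image iso) (image-cong F F≗edge)
      where
      open IsRootedIso iso
      F≗edge : F ≗ edge v (F (suc zero))
      F≗edge zero       = root
      F≗edge (suc zero) = refl
    pair⇒ : ∃ (λ x → adj H v x ≡ true × S ≡ pair v x) → ∃ (IsRootedIso K2 zero H v S)
    pair⇒ (x , vx , refl) = edge v x , image-isRootedIso refl injective preserves
      where
      injective : Injective _≡_ _≡_ (edge v x)
      injective {zero}     {zero}     _    = refl
      injective {zero}     {suc zero} v≡x  = contradiction v≡x (adj⇒≢ H vx)
      injective {suc zero} {zero}     x≡v  = contradiction (sym x≡v) (adj⇒≢ H vx)
      injective {suc zero} {suc zero} _    = refl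
      preserves : ∀ a b → adj K2 a b ≡ adj H (edge v x a) (edge v x b)
      preserves zero       zero       = sym (irrefl H v)
      preserves zero       (suc zero) = sym vx
      preserves (suc zero) zero       = sym (trans (Graph.sym H x v) vx)
      preserves (suc zero) (suc zero) = sym (irrefl H x)

  graphletDegree-K2 : graphletDegree H v K2 zero ≡ degree H v
  graphletDegree-K2 = ≤-antisym
    (begin
      graphletDegree H v K2 zero             ≤⟨ length-mono-⊆ edges-unique edges⊆pairs ⟩
      length (map (pair v) (neighbours H v)) ≡⟨ length-map (pair v) (neighbours H v) ⟩
      degree H v                             ∎)
    (begin
      degree H v                             ≡⟨ length-map (pair v) (neighbours H v) ⟨
      length (map (pair v) (neighbours H v)) ≤⟨ length-mono-⊆ pairs-unique pairs⊆edges ⟩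
      graphletDegree H v K2 zero             ∎)
    where
    open ≤-Reasoning
    edges-unique : Unique (graphletSubsets H v K2 zero)
    edges-unique = Unique.filter⁺ _ (allSubsets-unique n)
    pairs-unique : Unique (map (pair v) (neighbours H v))
    pairs-unique = Unique.map⁺ (pair-injective {v = v}) (Unique.filter⁺ _ (Unique.allFin⁺ n))
    edges⊆pairs : graphletSubsets H v K2 zero ⊆ map (pair v) (neighbours H v)
    edges⊆pairs S∈ =
      let x , vx , S≡pair = to isRootedIso-K2⇔pair (to (∈-graphletSubsets H v K2 zero) S∈)
      in subst (_∈ map (pair v) (neighbours H v)) (sym S≡pair)
           (∈-map⁺ (pair v) (from (∈-neighbours H v) vx))
    pairs⊆edges : map (pair v) (neighbours H v) ⊆ graphletSubsets H v K2 zero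
    pairs⊆edges S∈ =
      let x , x∈ , S≡pair = ∈-map⁻ (pair v) S∈
      in from (∈-graphletSubsets H v K2 zero)
           (from isRootedIso-K2⇔pair (x , to (∈-neighbours H v) x∈ , S≡pair))

module _ {n} {G : Graph n} where

  open DecMembership (_≟_ {n}) using (_∈?_)

  vertices : ∀ {i j} → Walk G i j → List (Fin n)
  vertices {i} here       = [ i ]
  vertices {i} (step _ w) = i ∷ vertices w

  walk-chain : ∀ {i j y} (w : Walk G i j) → adj G j y ≡ true → Chain G (vertices w ++ [ y ])
  walk-chain here                 jy = cons jy one
  walk-chain (step ik here)       jy = cons ik (cons jy one)
  walk-chain (step ik w@(step _ _)) jy = cons ik (walk-chain w jy)

  suffixFrom : ∀ {i k j} (w : Walk G k j) → Unique (vertices w) → i ∈ vertices w →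
               Σ[ p ∈ Walk G i j ] Unique (vertices p) × vertices p ⊆ vertices w
  suffixFrom w@here       w!       (here refl) = w , w! , ⊆-refl
  suffixFrom w@(step _ _) w!       (here refl) = w , w! , ⊆-refl
  suffixFrom (step _ w)   (_ ∷ w!) (there i∈w) =
    let p , p! , p⊆w = suffixFrom w w! i∈w in p , p! , there ∘ p⊆w

  prefixTo : ∀ {i j y} (w : Walk G i j) → y ∈ vertices w →
             Σ[ p ∈ Walk G i y ] vertices p ⊆ vertices w
  prefixTo here        (here refl) = here , ⊆-refl
  prefixTo (step _ _)  (here refl) = here , ∷⁺ʳ _ (λ ())
  prefixTo (step ik w) (there y∈w) = let p , p⊆w = prefixTo w y∈w in step ik p , ∷⁺ʳ _ p⊆w

  toPath : ∀ {i j} (w : Walk G i j) →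
           Σ[ p ∈ Walk G i j ] Unique (vertices p) × vertices p ⊆ vertices w
  toPath here = here , All.[] ∷ [] , ⊆-refl
  toPath {i} (step ik w) with p , p! , p⊆w ← toPath w with i ∈? vertices p
  ... | yes i∈p = let q , q! , q⊆p = suffixFrom p p! i∈p in q , q! , there ∘ p⊆w ∘ q⊆p
  ... | no  i∉p = step ik p , ¬Any⇒All¬ _ i∉p ∷ p! , ∷⁺ʳ i p⊆w

  module _ (acyclic : Acyclic G) where

    walk-avoiding-common-neighbour⇒≡ : ∀ {x i j} → adj G x i ≡ true → adj G x j ≡ true →
                                       (w : Walk G i j) → x ∉ vertices w → i ≡ j
    walk-avoiding-common-neighbour⇒≡ {x} {i} {j} xi xj w x∉w
      with p , p! , p⊆w ← toPath w = path⇒≡ p p! (x∉w ∘ p⊆w)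
      where
      path⇒≡ : (p : Walk G i j) → Unique (vertices p) → x ∉ vertices p → i ≡ j
      path⇒≡ here           _  _   = refl
      path⇒≡ p@(step _ q) p! x∉p =
        contradiction (¬Any⇒All¬ _ x∉p ∷ p! , s≤s (length>0 q) , cons xi (walk-chain p jx))
                      (acyclic x (vertices p))
        where
        jx : adj G j x ≡ true
        jx = trans (Graph.sym G _ x) xj
        length>0 : ∀ {k l} (q : Walk G k l) → 0 < length (vertices q)
        length>0 here       = z<s
        length>0 (step _ _) = z<s

record Leaf {n} (G : Graph n) (ℓ u : Fin n) : Set where
  field
    attached      : adj G ℓ u ≡ true
    only-neighbour : ∀ y → adj G ℓ y ≡ true → y ≡ u

open Leaf

unique⇒length≤ : ∀ {n} {xs : List (Fin n)} → Unique xs → length xs ≤ n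
unique⇒length≤ {n} xs! =
  ≤-trans (length-mono-⊆ xs! (λ {x} _ → ∈-allFin x)) (≤-reflexive (length-tabulate {n = n} id))

module _ {n} {G : Graph n} (acyclic : Acyclic G) where

  open DecMembership (_≟_ {n}) using (_∈?_)

  maximal-path⇒leaf : ∀ {e p s} (ep : adj G e p ≡ true) (w : Walk G p s) →
                      Unique (vertices (step ep w)) →
                      (∀ y → adj G e y ≡ true → y ∈ vertices (step ep w)) → Leaf G e p
  maximal-path⇒leaf {e} {p} ep w (e∉w ∷ _) closed = record { attached = ep ; only-neighbour = only-p }
    where
    only-p : ∀ y → adj G e y ≡ true → y ≡ p
    only-p y ey with closed y ey
    ... | here refl  = contradiction refl (adj⇒≢ G ey)
    ... | there y∈w  = let q , q⊆w = prefixTo w y∈w in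
      sym (walk-avoiding-common-neighbour⇒≡ acyclic ep ey q (All¬⇒¬Any e∉w ∘ q⊆w))

  longest-path⇒leaf : ∀ m {e p s} (ep : adj G e p ≡ true) (w : Walk G p s) →
                      Unique (vertices (step ep w)) →
                      n ≤ m + length (vertices (step ep w)) → ∃₂ (Leaf G)
  longest-path⇒leaf m {e} ep w w! n≤
    with any? (λ y → (adj G e y ≟ᵇ true) ×-dec ¬? (y ∈? vertices (step ep w)))
  ... | no closed = e , _ , maximal-path⇒leaf ep w w! λ y ey →
                      decidable-stable (y ∈? _) λ y∉ → closed (y , ey , y∉)
  ... | yes (y , ey , y∉) with m
  ...   | zero  = contradiction (unique⇒length≤ (¬Any⇒All¬ _ y∉ ∷ w!)) (<⇒≱ (s≤s n≤))
  ...   | suc m = longest-path⇒leaf m (trans (Graph.sym G y e) ey) (step ep w) (¬Any⇒All¬ _ y∉ ∷ w!)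
                    (≤-trans n≤ (≤-reflexive (sym (+-suc m _))))

leaf-exists : ∀ {n} (T : Graph (suc (suc n))) → Tree T → ∃₂ (Leaf T)
leaf-exists {n} T (connected , acyclic) with connected zero (suc zero)
... | step {k = k} 0k _ = longest-path⇒leaf acyclic (suc (suc n)) 0k here
                            ((adj⇒≢ T 0k All.∷ All.[]) ∷ All.[] ∷ []) (m≤m+n _ _)

removeVertex : ∀ {n} → Graph (suc n) → Fin (suc n) → Graph n
removeVertex G ℓ = record
  { adj    = λ a b → adj G (punchIn ℓ a) (punchIn ℓ b)
  ; sym    = λ a b → Graph.sym G (punchIn ℓ a) (punchIn ℓ b)
  ; irrefl = λ a → irrefl G (punchIn ℓ a)
  }

data PunchInView {n} (ℓ : Fin (suc n)) : Fin (suc n) → Set where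
  at        : PunchInView ℓ ℓ
  punchedIn : ∀ a → PunchInView ℓ (punchIn ℓ a)

punchInView : ∀ {n} (ℓ z : Fin (suc n)) → PunchInView ℓ z
punchInView ℓ z with ℓ ≟ z
... | yes refl = at
... | no  ℓ≢z  = subst (PunchInView ℓ) (punchIn-punchOut ℓ≢z) (punchedIn (punchOut ℓ≢z))

module _ {n} {G : Graph (suc n)} {ℓ u} (leaf : Leaf G ℓ u) where

  -- a walk entering the leaf ℓ must leave it again towards u, so the detour can be cut out
  walk-avoiding-leaf : ∀ {i j} → Walk G i j → ∀ {a b} → punchIn ℓ a ≡ i → punchIn ℓ b ≡ j →
                       Walk (removeVertex G ℓ) a b
  walk-avoiding-leaf here {a} {b} refl b≡a = subst (Walk _ a) (punchIn-injective ℓ a b (sym b≡a)) here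
  walk-avoiding-leaf (step {k = k} ik w) refl b≡ with punchInView ℓ k
  ... | punchedIn c = step ik (walk-avoiding-leaf w refl b≡)
  ... | at with w
  ...   | here        = contradiction b≡ (punchInᵢ≢i ℓ _)
  ...   | step ℓk′ w′ = walk-avoiding-leaf w′ (trans (only-neighbour leaf _ (trans (Graph.sym G ℓ _) ik))
                                                      (sym (only-neighbour leaf _ ℓk′))) b≡

  removeLeaf-connected : Connected G → Connected (removeVertex G ℓ)
  removeLeaf-connected connected a b = walk-avoiding-leaf (connected (punchIn ℓ a) (punchIn ℓ b)) refl refl

module _ {m n} {G : Graph m} {H : Graph n} {F : Fin m → Fin n}
         (preserves : ∀ a b → adj G a b ≡ adj H (F a) (F b)) where

  walk-map : ∀ {i j} → Walk G i j → Walk H (F i) (F j)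
  walk-map here        = here
  walk-map (step ik w) = step (trans (sym (preserves _ _)) ik) (walk-map w)

  walk-map-avoids : ∀ {x} → (∀ a → F a ≢ x) → ∀ {i j} (w : Walk G i j) → x ∉ vertices (walk-map w)
  walk-map-avoids x∉F here       (here x≡Fi) = x∉F _ (sym x≡Fi)
  walk-map-avoids x∉F (step _ w) (here x≡Fi) = x∉F _ (sym x≡Fi)
  walk-map-avoids x∉F (step _ w) (there x∈)  = walk-map-avoids x∉F w x∈

section-injective : ∀ {A B : Set} {f : A → B} (s : ∀ y → ∃ λ x → f x ≡ y) →
                    Injective _≡_ _≡_ (proj₁ ∘ s)
section-injective {f = f} s {y} {y′} e = trans (sym (proj₂ (s y))) (trans (cong f e) (proj₂ (s y′)))

injective⇒missing : ∀ {n} {F : Fin n → Fin (suc n)} → Injective _≡_ _≡_ F → ∃ λ w → ∀ a → F a ≢ w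
injective⇒missing {n} {F} _ =
  let w , not-hit = ¬∀⟶∃¬ (suc n) (λ w → ∃ λ a → F a ≡ w) (λ w → any? λ a → F a ≟ w)
                      λ onto → 1+n≰n (injective⇒≤ (section-injective onto))
  in w , λ a Fa≡w → not-hit (a , Fa≡w)

injective⇒surjective : ∀ {n} {f : Fin (suc n) → Fin (suc n)} → Injective _≡_ _≡_ f →
                       ∀ y → ∃ λ x → f x ≡ y
injective⇒surjective {f = f} f-injective y with any? (λ x → f x ≟ y)
... | yes hit = hit
... | no  ¬hit = contradiction
  (injective⇒≤ {f = λ x → punchOut (miss x)} λ {x} {x′} → f-injective ∘ punchOut-injective (miss x) (miss x′))
  1+n≰n
  where
  miss : ∀ x → y ≢ f x
  miss x = ¬hit ∘ (x ,_) ∘ sym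

injective⇒↔ : ∀ {n} {f : Fin (suc n) → Fin (suc n)} → Injective _≡_ _≡_ f → Fin (suc n) ↔ Fin (suc n)
injective⇒↔ {f = f} f-injective =
  mk↔ₛ′ f (proj₁ ∘ onto) (proj₂ ∘ onto) (λ x → f-injective (proj₂ (onto (f x))))
  where
  onto : ∀ y → ∃ λ x → f x ≡ y
  onto = injective⇒surjective f-injective

module Extension {n} {F : Fin n → Fin (suc n)} (F-injective : Injective _≡_ _≡_ F)
                 (ℓ w : Fin (suc n)) (w∉F : ∀ a → F a ≢ w) where

  extend : Fin (suc n) → Fin (suc n)
  extend z with ℓ ≟ z
  ... | yes _   = w
  ... | no ℓ≢z = F (punchOut ℓ≢z)

  extend-ℓ : extend ℓ ≡ w
  extend-ℓ with ℓ ≟ ℓ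
  ... | yes _   = refl
  ... | no ℓ≢ℓ = contradiction refl ℓ≢ℓ

  extend-punchIn : ∀ a → extend (punchIn ℓ a) ≡ F a
  extend-punchIn a with ℓ ≟ punchIn ℓ a
  ... | yes ℓ≡ = contradiction (sym ℓ≡) (punchInᵢ≢i ℓ a)
  ... | no ℓ≢ = cong F (punchIn-injective ℓ _ a (punchIn-punchOut ℓ≢))

  extend-injective : Injective _≡_ _≡_ extend
  extend-injective {x} {y} e with punchInView ℓ x | punchInView ℓ y
  ... | at          | at          = refl
  ... | at          | punchedIn b =
    contradiction (trans (sym (extend-punchIn b)) (trans (sym e) extend-ℓ)) (w∉F b)
  ... | punchedIn a | at          =
    contradiction (trans (sym (extend-punchIn a)) (trans e extend-ℓ)) (w∉F a)
  ... | punchedIn a | punchedIn b =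
    cong (punchIn ℓ) (F-injective (trans (sym (extend-punchIn a)) (trans e (extend-punchIn b))))

  hit-unless-missing : ∀ y → y ≢ w → ∃ λ a → F a ≡ y
  hit-unless-missing y y≢w
    with x , refl ← injective⇒surjective extend-injective y
    with punchInView ℓ x
  ... | at          = contradiction extend-ℓ y≢w
  ... | punchedIn a = a , sym (extend-punchIn a)

degree-< : ∀ {m n} {H : Graph m} {H′ : Graph n} {v v′ x} (h : Fin n → Fin m) → Injective _≡_ _≡_ h →
           adj H v x ≡ true → (∀ y → adj H′ v′ y ≡ true → adj H v (h y) ≡ true × h y ≢ x) →
           degree H′ v′ < degree H v
degree-< {n = n} {H} {H′} {v} {v′} {x} h h-injective vx h-maps = begin-strict
  degree H′ v′                          ≡⟨ length-map h (neighbours H′ v′) ⟨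
  length (map h (neighbours H′ v′))     <⟨ ≤-refl ⟩
  length (x ∷ map h (neighbours H′ v′)) ≤⟨ length-mono-⊆ (x∉ ∷ Unique.map⁺ h-injective nbrs-unique) ⊆nbrs ⟩
  degree H v                            ∎
  where
  open ≤-Reasoning
  nbrs-unique : Unique (neighbours H′ v′)
  nbrs-unique = Unique.filter⁺ _ (Unique.allFin⁺ n)
  x∉ : All.All (x ≢_) (map h (neighbours H′ v′))
  x∉ = ¬Any⇒All¬ _ λ x∈ → let y , y∈ , x≡hy = ∈-map⁻ h x∈ in
         proj₂ (h-maps y (to (∈-neighbours H′ v′) y∈)) (sym x≡hy)
  ⊆nbrs : x ∷ map h (neighbours H′ v′) ⊆ neighbours H v
  ⊆nbrs (here refl) = from (∈-neighbours H v) vx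
  ⊆nbrs (there z∈)  with y , y∈ , refl ← ∈-map⁻ h z∈ =
    from (∈-neighbours H v) (proj₁ (h-maps y (to (∈-neighbours H′ v′) y∈)))

module LeafExtension {n} {T T′ : Graph (suc n)} {ℓ u₀} (leaf : Leaf T ℓ (punchIn ℓ u₀))
  (T-connected : Connected T) (T′-acyclic : Acyclic T′)
  {F : Fin n → Fin (suc n)} (F-injective : Injective _≡_ _≡_ F)
  (F-preserves : ∀ a b → adj (removeVertex T ℓ) a b ≡ adj T′ (F a) (F b))
  (degree≤ : degree T (punchIn ℓ u₀) ≤ degree T′ (F u₀)) where

  w : Fin (suc n)
  w = proj₁ (injective⇒missing F-injective)

  w∉F : ∀ a → F a ≢ w
  w∉F = proj₂ (injective⇒missing F-injective)

  open Extension F-injective ℓ w w∉F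
  open ≡-Reasoning

  T-ℓ-connected : Connected (removeVertex T ℓ)
  T-ℓ-connected = removeLeaf-connected leaf T-connected

  g : Fin (suc n) ↔ Fin (suc n)
  g = injective⇒↔ extend-injective

  g⁻¹ : Fin (suc n) → Fin (suc n)
  g⁻¹ = Inverse.from g

  g⁻¹-injective : Injective _≡_ _≡_ g⁻¹
  g⁻¹-injective = section-injective {f = extend} λ y → g⁻¹ y , Inverse.strictlyInverseˡ g y

  g⁻¹-F : ∀ a → g⁻¹ (F a) ≡ punchIn ℓ a
  g⁻¹-F a = trans (cong g⁻¹ (sym (extend-punchIn a))) (Inverse.strictlyInverseʳ g _)

  -- otherwise g⁻¹ maps the neighbours of F u₀ injectively to neighbours of punchIn ℓ u₀ other than ℓ
  F-u₀~w : adj T′ (F u₀) w ≡ true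
  F-u₀~w with adj T′ (F u₀) w in F-u₀≁w
  ... | true  = refl
  ... | false = contradiction degree≤ (<⇒≱ (degree-< {H = T} {H′ = T′} g⁻¹ g⁻¹-injective
                  (trans (Graph.sym T _ ℓ) (attached leaf)) maps-neighbours))
    where
    maps-neighbours : ∀ y → adj T′ (F u₀) y ≡ true → adj T (punchIn ℓ u₀) (g⁻¹ y) ≡ true × g⁻¹ y ≢ ℓ
    maps-neighbours y F-u₀~y
      with a , refl ← hit-unless-missing y (λ { refl → contradiction (trans (sym F-u₀~y) F-u₀≁w) λ () })
      rewrite g⁻¹-F a = trans (F-preserves u₀ a) F-u₀~y , punchInᵢ≢i ℓ a

  -- a second neighbour F a of w would close a cycle with the image of a walk from a to u₀ in T − ℓ
  w-leaf : Leaf T′ w (F u₀)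
  w-leaf = record { attached = trans (Graph.sym T′ w _) F-u₀~w ; only-neighbour = λ y w~y →
    let a , Fa≡y = hit-unless-missing y (adj⇒≢ T′ w~y ∘ sym)
        w~Fa = subst (λ z → adj T′ w z ≡ true) (sym Fa≡y) w~y
        w~F-u₀ = trans (Graph.sym T′ w _) F-u₀~w
    in trans (sym Fa≡y) (walk-avoiding-common-neighbour⇒≡ T′-acyclic w~Fa w~F-u₀
                           (walk-map F-preserves (T-ℓ-connected a u₀)) (walk-map-avoids F-preserves w∉F _)) }

  adj-w : ∀ b → adj T′ w (F b) ≡ adj T ℓ (punchIn ℓ b)
  adj-w b = ⇔→≡ (mk⇔
    (λ w~Fb → subst (λ c → adj T ℓ (punchIn ℓ c) ≡ true)
                    (sym (F-injective (only-neighbour w-leaf _ w~Fb))) (attached leaf))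
    (λ ℓ~b → subst (λ c → adj T′ w (F c) ≡ true)
                   (sym (punchIn-injective ℓ _ _ (only-neighbour leaf _ ℓ~b))) (attached w-leaf)))

  isIso : IsIso T T′ g
  isIso i j with punchInView ℓ i | punchInView ℓ j
  ... | at | at = begin
    adj T′ (extend ℓ) (extend ℓ) ≡⟨ cong₂ (adj T′) extend-ℓ extend-ℓ ⟩
    adj T′ w w                   ≡⟨ irrefl T′ w ⟩
    false                        ≡⟨ irrefl T ℓ ⟨
    adj T ℓ ℓ                    ∎
  ... | at | punchedIn b = begin
    adj T′ (extend ℓ) (extend (punchIn ℓ b)) ≡⟨ cong₂ (adj T′) extend-ℓ (extend-punchIn b) ⟩
    adj T′ w (F b)                           ≡⟨ adj-w b ⟩
    adj T ℓ (punchIn ℓ b)                    ∎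
  ... | punchedIn a | at = begin
    adj T′ (extend (punchIn ℓ a)) (extend ℓ) ≡⟨ cong₂ (adj T′) (extend-punchIn a) extend-ℓ ⟩
    adj T′ (F a) w                           ≡⟨ Graph.sym T′ (F a) w ⟩
    adj T′ w (F a)                           ≡⟨ adj-w a ⟩
    adj T ℓ (punchIn ℓ a)                    ≡⟨ Graph.sym T ℓ _ ⟩
    adj T (punchIn ℓ a) ℓ                    ∎
  ... | punchedIn a | punchedIn b = begin
    adj T′ (extend (punchIn ℓ a)) (extend (punchIn ℓ b))
      ≡⟨ cong₂ (adj T′) (extend-punchIn a) (extend-punchIn b) ⟩
    adj T′ (F a) (F b)                                   ≡⟨ F-preserves a b ⟨
    adj T (punchIn ℓ a) (punchIn ℓ b)                    ∎

  isomorphic : Isomorphic T T′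
  isomorphic = g , isIso

module _ {m n} (H H′ : Graph n) (gdd : SameGDD m H H′) where

  private
    σ : Fin n → Fin n
    σ = Inverse.to (proj₁ gdd)

  SameGDD-transfers : ∀ {k} {G : Graph (suc k)} {r v S F} → suc k ≤ m → suc k < n → Connected G →
                      IsRootedIso G r H v S F → ∃₂ (IsRootedIso G r H′ (σ v))
  SameGDD-transfers {k} {G} {r} {v} k<m k<n G-connected iso =
    to (graphletDegree>0⇔ H′ (σ v) G r)
      (subst (0 <_) (proj₂ gdd k k<m k<n G G-connected r v)
        (from (graphletDegree>0⇔ H v G r) (_ , _ , iso)))

  SameGDD⇒degree≡ : 2 ≤ m → 2 < n → ∀ v → degree H v ≡ degree H′ (σ v)
  SameGDD⇒degree≡ 2≤m 2<n v = begin
    degree H v                      ≡⟨ graphletDegree-K2 H v ⟨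
    graphletDegree H v K2 zero      ≡⟨ proj₂ gdd 1 2≤m 2<n K2 K2-connected zero v ⟩
    graphletDegree H′ (σ v) K2 zero ≡⟨ graphletDegree-K2 H′ (σ v) ⟩
    degree H′ (σ v)                 ∎
    where open ≡-Reasoning

mainTheorem3 : (n : ℕ) → 3 ≤ n → (T T' : Graph n) → Tree T → Tree T' →
    SameGDD (n ∸ 1) T T' → Isomorphic T T'
mainTheorem3 (suc (suc (suc m))) (s≤s (s≤s (s≤s _))) T T′ tree@(connected , _) (_ , T′-acyclic)
             gdd@(σ , _)
  with ℓ , u , leaf ← leaf-exists T tree
  with punchInView ℓ u
... | at           = contradiction refl (adj⇒≢ T (attached leaf))
... | punchedIn u₀ =
  extend-to-iso (SameGDD-transfers T T′ gdd ≤-refl ≤-refl (removeLeaf-connected leaf connected) T-ℓ-at-u)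
  where
  T-ℓ-at-u : IsRootedIso (removeVertex T ℓ) u₀ T (punchIn ℓ u₀) (image (punchIn ℓ)) (punchIn ℓ)
  T-ℓ-at-u = image-isRootedIso refl (punchIn-injective ℓ _ _) λ _ _ → refl

  extend-to-iso : ∃₂ (IsRootedIso (removeVertex T ℓ) u₀ T′ (Inverse.to σ (punchIn ℓ u₀))) → Isomorphic T T′
  extend-to-iso (_ , F , iso) =
    LeafExtension.isomorphic leaf connected T′-acyclic injective preserves (≤-reflexive (begin
      degree T (punchIn ℓ u₀)                 ≡⟨ SameGDD⇒degree≡ T T′ gdd 2≤2+m 2<3+m _ ⟩
      degree T′ (Inverse.to σ (punchIn ℓ u₀)) ≡⟨ cong (degree T′) root ⟨
      degree T′ (F u₀)                        ∎))
    where
    open IsRootedIso iso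
    open ≡-Reasoning
    2≤2+m : 2 ≤ 2 + m
    2≤2+m = s≤s (s≤s z≤n)
    2<3+m : 2 < 3 + m
    2<3+m = s≤s (s≤s (s≤s z≤n))
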